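{- Let $F$ be a type with $\Gamma,\beta:\mathbb{V}\vdash F\;\mathrm{type}$. There is a term $\mathrm{TI}^{\mathsf{tc}}:\Pi_{(\alpha:\mathbb{V})}(\forall\gamma\in\mathsf{tc}(\alpha)\,F[\gamma/\beta]\to F[\alpha/\beta])\to\Pi_{(\alpha:\mathbb{V})}F[\alpha/\beta]$ such that, in $\mathbf{MLM}$ extended with Function Extensionality, for any $g:\Pi_{(\alpha:\mathbb{V})}(\forall\gamma\in\mathsf{tc}(\alpha)\,F[\gamma/\beta]\to F[\alpha/\beta])$ and any $\alpha:\mathbb{V}$ we have $\mathrm{TI}^{\mathsf{tc}}\,g\,\alpha=_{F[\alpha/\beta]}g\,\alpha\,(\lambda x.\mathrm{TI}^{\mathsf{tc}}\,g\,(\mathsf{pred}\,\mathsf{tc}(\alpha)\,x))$.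
   Context: $\mathbf{MLM}$ is intensional Martin-Löf type theory ($\Pi,\Sigma,+,\mathrm{N},\mathrm{N}_n,\mathrm{W}$, intensional identity types $a=_A b$) with Setzer's Mahlo universe $\mathbb{M}$ with decoding $\mathrm{T}_{\mathbb{M}}$, closed in particular under codes $\widehat{\Sigma}_{\mathbb{M}},\widehat{+}_{\mathbb{M}}$ decoding to $\Sigma$ and $+$. Function Extensionality: for $\Gamma,x:A\vdash B\;\mathrm{type}$, $\Pi_{(f,g:\Pi_{(x:A)}B)}(\Pi_{(x:A)}f\,x=_B g\,x\to f=_{\Pi_{(x:A)}B}g)$ is inhabited (it holds in particular in the extensional variant $\mathbf{MLM_{ext}}$ with extensional identity types). $\mathbb{V}:=\mathrm{W}_{(x:\mathbb{M})}\mathrm{T}_{\mathbb{M}}(x)$, $\mathsf{index}(\mathsf{sup}(a,f))=a$, $\mathsf{pred}(\mathsf{sup}(a,f))=f$, $\overline{\alpha}:=\mathrm{T}_{\mathbb{M}}(\mathsf{index}\,\alpha)$, $\forall\gamma\in\alpha\,G:=\Pi_{(x:\overline{\alpha})}G[\mathsf{pred}\,\alpha\,x/\gamma]$. $\bigcup\mathsf{sup}(a,f):=\mathsf{sup}(\widehat{\Sigma}_{\mathbb{M}}(a,\lambda x.\mathsf{index}(f\,x)),\lambda(x,y).\mathsf{pred}(f\,x)\,y)$, $\mathsf{sup}(a,f)\cup\mathsf{sup}(b,g):=\mathsf{sup}(a\,\widehat{+}_{\mathbb{M}}b,[f,g])$, $\mathsf{tc}(\mathsf{sup}(a,f)):=\mathsf{sup}(a,f)\cup\bigcup\mathsf{sup}(a,\lambda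 x.\mathsf{tc}(f\,x))$. -}

module Defs where

open import Data.Product using (Σ; _,_; proj₁; proj₂)
open import Data.Sum using (_⊎_; [_,_])
open import Function using (id)
open import Relation.Binary.PropositionalEquality using (_≡_; subst)

-- A universe (à la Tarski) closed under codes Σ̂ and +̂ decoding to Σ and +.
-- These are the only features of Setzer's Mahlo universe 𝕄 used by the
-- definitions of 𝕍, ⋃, ∪, tc.  Decoding equations are given as (propositional)
-- equalities of types; for 𝕄 itself they hold definitionally (refl).
record Universe : Set₁ where
  field
    M   : Set
    T   : M → Set
    Σ̂   : (a : M) → (T a → M) → M
    _+̂_ : M → M → M
    TΣ̂  : ∀ a b → T (Σ̂ a b) ≡ Σ (T a) (λ x → T (b x))
    T+̂  : ∀ a b → T (a +̂ b) ≡ (T a ⊎ T b)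

coe : {A B : Set} → A ≡ B → A → B
coe = subst id

module _ (U : Universe) where
  open Universe U

  data 𝕍 : Set where
    sup : (a : M) → (T a → 𝕍) → 𝕍

  index : 𝕍 → M
  index (sup a f) = a

  pred : (α : 𝕍) → T (index α) → 𝕍
  pred (sup a f) = f

  El : 𝕍 → Set
  El α = T (index α)

  ∀∈ : 𝕍 → (𝕍 → Set) → Set
  ∀∈ α G = (x : El α) → G (pred α x)

  ⋃ : 𝕍 → 𝕍
  ⋃ (sup a f) =
    sup (Σ̂ a (λ x → index (f x)))
        (λ z → pred (f (proj₁ (coe (TΣ̂ a (λ x → index (f x))) z)))
                    (proj₂ (coe (TΣ̂ a (λ x → index (f x))) z)))

  _∪_ : 𝕍 → 𝕍 → 𝕍
  sup a f ∪ sup b g = sup (a +̂ b) (λ z → [ f , g ] (coe (T+̂ a b) z))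

  tc : 𝕍 → 𝕍
  tc (sup a f) = sup a f ∪ ⋃ (sup a (λ x → tc (f x)))

-- The members of tc (sup a f) are the f x together with the members of the
-- tc (f x).  So a family over the members of tc α can be built by structural
-- recursion on α, calling TI on the immediate members and recursing on them
-- for the rest; TI α is g applied to that family.  The same recursion shows
-- that the family agrees pointwise with TI, and function extensionality turns
-- this into the fixed-point equation.
module Submission where

open import Defs
open import Data.Product using (Σ; _,_)
open import Data.Sum using (inj₁; inj₂)
open import Level using (0ℓ)
open import Relation.Binary.PropositionalEquality using (_≡_; refl; cong)
open import Axiom.Extensionality.Propositional using (Extensionality)

module _ {U : Universe} where
  open Universe U using (M; T; TΣ̂; T+̂)

  ∀∈-tc-sup : {a : M} {f : T a → 𝕍 U} (G : 𝕍 U → Set) →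
              ((x : T a) → G (f x)) → ((x : T a) → ∀∈ U (tc U (f x)) G) →
              ∀∈ U (tc U (sup a f)) G
  ∀∈-tc-sup {a} G now later z with coe (T+̂ a _) z
  ... | inj₁ x = now x
  ... | inj₂ w with coe (TΣ̂ a _) w
  ...   | x , y = later x y

  ∀∈-tc-sup-≡ : {a : M} {f : T a → 𝕍 U} {G : 𝕍 U → Set} (k : (β : 𝕍 U) → G β)
                {now : (x : T a) → G (f x)} {later : (x : T a) → ∀∈ U (tc U (f x)) G} →
                ((x : T a) → now x ≡ k (f x)) →
                ((x : T a) (y : El U (tc U (f x))) → later x y ≡ k (pred U (tc U (f x)) y)) →
                (z : El U (tc U (sup a f))) →
                ∀∈-tc-sup G now later z ≡ k (pred U (tc U (sup a f)) z)
  ∀∈-tc-sup-≡ {a} k now≡ later≡ z with coe (T+̂ a _) z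
  ... | inj₁ x = now≡ x
  ... | inj₂ w with coe (TΣ̂ a _) w
  ...   | x , y = later≡ x y

module TransfiniteInduction (U : Universe) (F : 𝕍 U → Set)
                            (g : (α : 𝕍 U) → ∀∈ U (tc U α) F → F α) where

  mutual
    TI : (α : 𝕍 U) → F α
    TI α = g α (TI-below α)

    TI-below : (α : 𝕍 U) → ∀∈ U (tc U α) F
    TI-below (sup a f) = ∀∈-tc-sup F (λ x → TI (f x)) (λ x → TI-below (f x))

  TI-below≡TI : (α : 𝕍 U) (x : El U (tc U α)) → TI-below α x ≡ TI (pred U (tc U α) x)
  TI-below≡TI (sup a f) = ∀∈-tc-sup-≡ TI (λ x → refl) (λ x → TI-below≡TI (f x))

lemmaB2 : (U : Universe) (F : 𝕍 U → Set) →
    Σ (((α : 𝕍 U) → ∀∈ U (tc U α) F → F α) → (α : 𝕍 U) → F α)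
    (λ TI → Extensionality 0ℓ 0ℓ →
    (g : (α : 𝕍 U) → ∀∈ U (tc U α) F → F α) (α : 𝕍 U) →
    TI g α ≡ g α (λ x → TI g (pred U (tc U α) x)))
lemmaB2 U F = TI , λ ext g α → cong (g α) (ext (TI-below≡TI g α))
  where open TransfiniteInduction U F using (TI; TI-below≡TI)
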